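{- Let $p$ be a prime, $n \ge 1$ an integer, $N = p^n - 1$, $q \ge 2$ an integer coprime to $p$, and $a \ge 0$ an integer. Let $S_a = \{a, a+q, a+2q, \ldots\} \cap \{0,1,\ldots,N\}$. Let $f \in F_p[x_1,\ldots,x_N]/(x_1^2 - x_1,\ldots,x_N^2 - x_N)$ be a nonzero symmetric function of the form $f = \sum_{i \in S_a} c_i \sigma_i$ with $c_i \in F_p$, and suppose $f(x) = 0$ for every $x \in \{0,1\}^N$ with $|x| \ge d$. Then $$d \ge N\left(1 - \frac{1}{p^{\ell}}\right), \qquad \text{where } \ell = \lfloor \log_p(q-1) \rfloor.$$
   Context: $\sigma_i$ is the elementary symmetric polynomial of degree $i$ in $x_1,\ldots,x_N$; $|x| = x_1 + \cdots + x_N$. Elements of the quotient ring are identified with functions $\{0,1\}^N \to F_p$. -}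

module Defs where

open import Data.Nat using (ℕ; zero; suc; _+_; _*_; _^_; _≤_; _<_; _≤ᵇ_)
open import Data.Bool using (Bool; true; false; if_then_else_)
open import Data.Vec using (Vec; []; _∷_)
open import Data.Fin using (Fin; toℕ)
open import Data.Product using (_×_)

bit : Bool → ℕ
bit true  = 1
bit false = 0

weight : ∀ {N} → Vec Bool N → ℕ
weight []       = 0
weight (b ∷ xs) = bit b + weight xs

-- Value of the elementary symmetric polynomial σ_i at x (computed in ℕ,
-- to be read modulo p), via σ_i(x₁,…,x_N) = σ_i(x₂,…) + x₁ σ_{i-1}(x₂,…).
esym : ∀ {N} → ℕ → Vec Bool N → ℕ
esym zero    xs       = 1
esym (suc i) []       = 0
esym (suc i) (b ∷ xs) = esym (suc i) xs + bit b * esym i xs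

sumTo : ℕ → (ℕ → ℕ) → ℕ
sumTo zero    g = g 0
sumTo (suc m) g = sumTo m g + g (suc m)

-- Summing over k = 0..N of the index i = a + k q
-- (keeping only i ≤ N) enumerates S_a exactly once each (q ≥ 1).
-- Coefficients c_i ∈ F_p are given by representatives in Fin p.
fEval : ∀ {N} (p q a : ℕ) → (ℕ → Fin p) → Vec Bool N → ℕ
fEval {N} p q a c x =
  sumTo N (λ k → if (a + k * q) ≤ᵇ N
                 then toℕ (c (a + k * q)) * esym (a + k * q) x
                 else 0)

IsFloorLog : (p m ℓ : ℕ) → Set
IsFloorLog p m ℓ = (p ^ ℓ ≤ m) × (m < p ^ suc ℓ)

module Submission where

open import Defs
open import Data.Nat using (ℕ; _+_; _*_; _∸_; _^_; _≤_; _≥_)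
open import Data.Nat.Primality using (Prime)
open import Data.Nat.Coprimality using (Coprime)
open import Data.Nat.Divisibility using (_∣_)
open import Data.Fin using (Fin)
open import Data.Vec using (Vec)
open import Data.Bool using (Bool)
open import Data.Product using (∃)
open import Relation.Nullary using (¬_)

open import Data.Bool using (true; false; if_then_else_)
open import Data.Empty using (⊥-elim)
open import Data.Fin using (toℕ)
open import Data.Fin.Properties using (toℕ<n)
open import Data.Nat
open import Data.Nat.Combinatorics
  using (_C_; nCk+nC[k+1]≡[n+1]C[k+1]; nCk≡n!/k![n-k]!; k![n∸k]!∣n!; k>n⇒nCk≡0; nCn≡1)
open import Data.Nat.DivMod
open import Data.Nat.Divisibility
open import Data.Nat.Primality using (euclidsLemma; prime⇒nonZero; prime⇒nonTrivial)
open import Data.Nat.Properties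
open import Algebra.Properties.CommutativeSemigroup +-commutativeSemigroup using (interchange)
open import Data.Product using (_,_)
open import Data.Sum using (inj₁; inj₂; [_,_]′)
open import Data.Unit using (tt)
open import Data.Vec using ([]; _∷_)
open import Relation.Binary.Bundles using (Setoid)
import Relation.Binary.Construct.On as On
open import Relation.Binary.Definitions using (tri<; tri≈; tri>)
open import Relation.Binary.PropositionalEquality as ≡
  using (_≡_; _≢_; refl; sym; trans; subst; cong; cong₂; module ≡-Reasoning)
import Relation.Binary.Reasoning.Setoid
open import Relation.Nullary using (yes; no)

-- Since σ_i(x) = C(|x|, i), f(x) = Σ c_i C(|x|, i) depends only on the weight w = |x|.
-- Split N + 1 = p^e p^m with p^e ≤ q, put P = p^m and h = p^e - 1. For r < P, Lucas'
-- theorem gives C(hP + r, i) ≡ C(h, ⌊i/P⌋) C(r, i mod P) (mod p), and C(h, j) is prime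
-- to p for every j < p^e. As q ≥ p^e is prime to p, the indices a + kq ≤ N have pairwise
-- distinct residues modulo P. If d < hP, then f vanishes at every weight hP + r, and
-- induction on r shows that the coefficient of the index with residue r is zero, so
-- f = 0. Hence d ≥ (p^e - 1) p^m; take e = ℓ (or e = n when ℓ > n).

esym≡C : ∀ {N} i (x : Vec Bool N) → esym i x ≡ weight x C i
esym≡C zero    x            = refl
esym≡C (suc i) []           = refl
esym≡C (suc i) (false ∷ xs) = trans (+-identityʳ _) (esym≡C (suc i) xs)
esym≡C (suc i) (true ∷ xs)  = begin
  esym (suc i) xs + (esym i xs + 0)
    ≡⟨ cong₂ _+_ (esym≡C (suc i) xs) (trans (+-identityʳ _) (esym≡C i xs)) ⟩
  w C suc i + w C i   ≡⟨ +-comm (w C suc i) (w C i) ⟩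
  w C i + w C suc i   ≡⟨ nCk+nC[k+1]≡[n+1]C[k+1] w i ⟩
  suc w C suc i       ∎
  where
  open ≡-Reasoning
  w = weight xs

pascal : ∀ n k → suc n C suc k ≡ n C k + n C suc k
pascal n k = sym (nCk+nC[k+1]≡[n+1]C[k+1] n k)

pascal-pred : ∀ n k .{{_ : NonZero k}} → suc n C k ≡ n C pred k + n C k
pascal-pred n (suc k) = pascal n k

prime≢1 : ∀ {p} → Prime p → p ≢ 1
prime≢1 {p} pr p≡1 = <⇒≢ (nonTrivial⇒n>1 p {{prime⇒nonTrivial pr}}) (sym p≡1)

prime∤! : ∀ {p n} → Prime p → n < p → ¬ p ∣ n !
prime∤! {n = zero}  pr _   p∣1 = prime≢1 pr (∣1⇒≡1 p∣1)
prime∤! {n = suc n} pr n<p p∣n! with euclidsLemma (suc n) (n !) pr p∣n!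
... | inj₁ p∣1+n = <⇒≱ n<p (∣⇒≤ p∣1+n)
... | inj₂ p∣n!  = prime∤! pr (<-trans (n<1+n n) n<p) p∣n!

nCk*k![n∸k]!≡n! : ∀ {n k} → k ≤ n → (n C k) * (k ! * (n ∸ k) !) ≡ n !
nCk*k![n∸k]!≡n! {n} {k} k≤n =
  trans (cong (_* (k ! * (n ∸ k) !)) (nCk≡n!/k![n-k]! k≤n)) (m/n*n≡m (k![n∸k]!∣n! k≤n))
  where instance _ = k !* (n ∸ k) !≢0

prime∣pCk : ∀ {p k} → Prime p → 0 < k → k < p → p ∣ p C k
prime∣pCk {p@(suc p-1)} {k} pr 0<k k<p
  with euclidsLemma (p C k) (k ! * (p ∸ k) !) pr
         (subst (p ∣_) (sym (nCk*k![n∸k]!≡n! (<⇒≤ k<p))) (m∣m*n (p-1 !)))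
... | inj₁ p∣pCk = p∣pCk
... | inj₂ p∣k![p∸k]! with euclidsLemma (k !) ((p ∸ k) !) pr p∣k![p∸k]!
...   | inj₁ p∣k!     = ⊥-elim (prime∤! pr k<p p∣k!)
...   | inj₂ p∣[p∸k]! = ⊥-elim (prime∤! pr (∸-monoʳ-< 0<k (<⇒≤ k<p)) p∣[p∸k]!)

module Congruence (p : ℕ) .{{_ : NonZero p}} where

  ≈-setoid : Setoid _ _
  ≈-setoid = On.setoid (≡.setoid ℕ) (_% p)

  open Setoid ≈-setoid public
    using (_≈_) renaming (refl to ≈-refl; trans to ≈-trans; reflexive to ≡⇒≈)

  module ≈-Reasoning = Relation.Binary.Reasoning.Setoid ≈-setoid

  +-cong : ∀ {x x′ y y′} → x ≈ x′ → y ≈ y′ → x + y ≈ x′ + y′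
  +-cong {x} {x′} {y} {y′} x≈x′ y≈y′ = trans (%-distribˡ-+ x y p)
    (trans (cong₂ (λ u v → (u + v) % p) x≈x′ y≈y′) (sym (%-distribˡ-+ x′ y′ p)))

  *-cong : ∀ {x x′ y y′} → x ≈ x′ → y ≈ y′ → x * y ≈ x′ * y′
  *-cong {x} {x′} {y} {y′} x≈x′ y≈y′ = trans (%-distribˡ-* x y p)
    (trans (cong₂ (λ u v → (u * v) % p) x≈x′ y≈y′) (sym (%-distribˡ-* x′ y′ p)))

  ∣⇒≈0 : ∀ {x} → p ∣ x → x ≈ 0
  ∣⇒≈0 {x} p∣x = trans (n∣m⇒m%n≡0 x p p∣x) (sym (m*n%n≡0 0 p))

  ≈0⇒∣ : ∀ {x} → x ≈ 0 → p ∣ x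
  ≈0⇒∣ {x} x≈0 = m%n≡0⇒n∣m x p (trans x≈0 (m*n%n≡0 0 p))

  sumTo-≈0 : ∀ M {g : ℕ → ℕ} → (∀ {k} → k ≤ M → g k ≈ 0) → sumTo M g ≈ 0
  sumTo-≈0 zero    g≈0 = g≈0 z≤n
  sumTo-≈0 (suc M) g≈0 = +-cong (sumTo-≈0 M (λ k≤M → g≈0 (m≤n⇒m≤1+n k≤M))) (g≈0 ≤-refl)

  sumTo-≈-single : ∀ M {g : ℕ → ℕ} {k₀} → k₀ ≤ M →
                   (∀ {k} → k ≤ M → k ≢ k₀ → g k ≈ 0) → sumTo M g ≈ g k₀
  sumTo-≈-single zero    z≤n g≈0 = ≈-refl
  sumTo-≈-single (suc M) {g} {k₀} k₀≤1+M g≈0 with m≤n⇒m<n∨m≡n k₀≤1+M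
  ... | inj₁ (s≤s k₀≤M) = ≈-trans
    (+-cong (sumTo-≈-single M k₀≤M (λ k≤M → g≈0 (m≤n⇒m≤1+n k≤M)))
            (g≈0 ≤-refl (λ 1+M≡k₀ → <⇒≢ (s≤s k₀≤M) (sym 1+M≡k₀))))
    (≡⇒≈ (+-identityʳ (g k₀)))
  ... | inj₂ refl =
    +-cong (sumTo-≈0 M (λ k≤M → g≈0 (m≤n⇒m≤1+n k≤M) (<⇒≢ (s≤s k≤M)))) (≈-refl {g k₀})

-- Frobenius p P: (1 + X) ^ P ≡ 1 + X ^ P in 𝔽ₚ[X].
Frobenius : ℕ → ℕ → Set
Frobenius p P = ∀ {t} → 0 < t → t < P → p ∣ P C t

module Lucas {p P : ℕ} .{{_ : NonZero p}} .{{_ : NonZero P}} (frob : Frobenius p P) where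
  open Congruence p
  open ≈-Reasoning

  [x+P]Cs≈xCs : ∀ x {s} → s < P → (x + P) C s ≈ x C s
  [x+P]Cs≈xCs x       {zero}  _   = ≈-refl
  [x+P]Cs≈xCs zero    {suc s} s<P = ∣⇒≈0 (frob z<s s<P)
  [x+P]Cs≈xCs (suc x) {suc s} s<P = begin
    suc (x + P) C suc s
      ≡⟨ pascal (x + P) s ⟩
    (x + P) C s + (x + P) C suc s
      ≈⟨ +-cong ([x+P]Cs≈xCs x (<-trans (n<1+n s) s<P)) ([x+P]Cs≈xCs x s<P) ⟩
    x C s + x C suc s
      ≡⟨ pascal x s ⟨
    suc x C suc s
      ∎

  [x+P]C[y+P]≈xC[y+P]+xCy : ∀ x y → (x + P) C (y + P) ≈ x C (y + P) + x C y
  [x+P]C[y+P]≈xC[y+P]+xCy zero    zero    =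
    ≡⇒≈ (trans (nCn≡1 P) (cong (_+ 1) (sym (k>n⇒nCk≡0 (>-nonZero⁻¹ P)))))
  [x+P]C[y+P]≈xC[y+P]+xCy zero    (suc y) = ≡⇒≈ (k>n⇒nCk≡0 (m<n+m P z<s))
  [x+P]C[y+P]≈xC[y+P]+xCy (suc x) zero    = begin
    suc (x + P) C P
      ≡⟨ pascal-pred (x + P) P ⟩
    (x + P) C pred P + (x + P) C P
      ≈⟨ +-cong ([x+P]Cs≈xCs x (≤-reflexive (suc-pred P))) ([x+P]C[y+P]≈xC[y+P]+xCy x 0) ⟩
    x C pred P + (x C P + 1)
      ≡⟨ +-assoc (x C pred P) (x C P) 1 ⟨
    x C pred P + x C P + 1
      ≡⟨ cong (_+ 1) (pascal-pred x P) ⟨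
    suc x C P + 1
      ∎
  [x+P]C[y+P]≈xC[y+P]+xCy (suc x) (suc y) = begin
    suc (x + P) C suc (y + P)
      ≡⟨ pascal (x + P) (y + P) ⟩
    (x + P) C (y + P) + (x + P) C (suc y + P)
      ≈⟨ +-cong ([x+P]C[y+P]≈xC[y+P]+xCy x y) ([x+P]C[y+P]≈xC[y+P]+xCy x (suc y)) ⟩
    (x C (y + P) + x C y) + (x C suc (y + P) + x C suc y)
      ≡⟨ interchange (x C (y + P)) (x C y) _ _ ⟩
    (x C (y + P) + x C suc (y + P)) + (x C y + x C suc y)
      ≡⟨ cong₂ _+_ (pascal x (y + P)) (pascal x y) ⟨
    suc x C suc (y + P) + suc x C suc y
      ∎

  [1+h]P+r≡hP+r+P : ∀ h r → suc h * P + r ≡ h * P + r + P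
  [1+h]P+r≡hP+r+P h r = trans (+-assoc P (h * P) r) (+-comm P (h * P + r))

  lucas : ∀ {r s} → r < P → s < P → ∀ h j → (h * P + r) C (j * P + s) ≈ (h C j) * (r C s)
  lucas {r} {s} r<P s<P zero    zero    = ≡⇒≈ (sym (+-identityʳ (r C s)))
  lucas {r} {s} r<P s<P zero    (suc j) =
    ≡⇒≈ (k>n⇒nCk≡0 (<-≤-trans r<P (≤-trans (m≤m+n P (j * P)) (m≤m+n (suc j * P) s))))
  lucas {r} {s} r<P s<P (suc h) zero    = begin
    (suc h * P + r) C s  ≡⟨ cong (_C s) ([1+h]P+r≡hP+r+P h r) ⟩
    (h * P + r + P) C s  ≈⟨ [x+P]Cs≈xCs (h * P + r) s<P ⟩
    (h * P + r) C s      ≈⟨ lucas r<P s<P h zero ⟩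
    1 * (r C s)          ∎
  lucas {r} {s} r<P s<P (suc h) (suc j) = begin
    (suc h * P + r) C (suc j * P + s)
      ≡⟨ cong₂ _C_ ([1+h]P+r≡hP+r+P h r) ([1+h]P+r≡hP+r+P j s) ⟩
    (h * P + r + P) C (j * P + s + P)
      ≈⟨ [x+P]C[y+P]≈xC[y+P]+xCy (h * P + r) (j * P + s) ⟩
    (h * P + r) C (j * P + s + P) + (h * P + r) C (j * P + s)
      ≡⟨ cong (λ z → (h * P + r) C z + (h * P + r) C (j * P + s)) ([1+h]P+r≡hP+r+P j s) ⟨
    (h * P + r) C (suc j * P + s) + (h * P + r) C (j * P + s)
      ≈⟨ +-cong (lucas r<P s<P h (suc j)) (lucas r<P s<P h j) ⟩
    (h C suc j) * (r C s) + (h C j) * (r C s)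
      ≡⟨ *-distribʳ-+ (r C s) (h C suc j) (h C j) ⟨
    (h C suc j + h C j) * (r C s)
      ≡⟨ cong (_* (r C s)) (trans (+-comm (h C suc j) (h C j)) (sym (pascal h j))) ⟩
    (suc h C suc j) * (r C s)
      ∎

frobenius-^ : ∀ {p} → Prime p → ∀ m → Frobenius p (p ^ m)
frobenius-^ pr zero {suc t} _ (s≤s ())
frobenius-^ {p} pr (suc m) {t} 0<t t<pP = ≈0⇒∣ (begin
  (p * P) C t
    ≡⟨ cong₂ _C_ (sym (+-identityʳ (p * P))) t≡jP+s ⟩
  (p * P + 0) C (t / P * P + t % P)
    ≈⟨ Lucas.lucas (frobenius-^ pr m) (>-nonZero⁻¹ P) (m%n<n t P) p (t / P) ⟩
  (p C (t / P)) * (0 C (t % P))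
    ≈⟨ digits≈0 (t % P) refl ⟩
  0
    ∎)
  where
  instance
    _ = prime⇒nonZero pr
    _ = m^n≢0 p m
  P = p ^ m
  open Congruence p
  open ≈-Reasoning
  t≡jP+s : t ≡ t / P * P + t % P
  t≡jP+s = trans (m≡m%n+[m/n]*n t P) (+-comm (t % P) (t / P * P))
  digits≈0 : ∀ s → t % P ≡ s → (p C (t / P)) * (0 C s) ≈ 0
  digits≈0 (suc s) _   = ≡⇒≈ (*-zeroʳ (p C (t / P)))
  digits≈0 zero    s≡0 = ∣⇒≈0 (∣m⇒∣m*n 1 (prime∣pCk pr 0<j (m<n*o⇒m/o<n t<pP)))
    where
    0<j : 0 < t / P
    0<j = m≥n⇒m/n>0 (∣⇒≤ {{>-nonZero 0<t}} (m%n≡0⇒n∣m t P s≡0))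

frobenius⇒∤[P∸1]C : ∀ {p P} → Prime p → Frobenius p P → ∀ {j} → j < P → ¬ p ∣ (P ∸ 1) C j
frobenius⇒∤[P∸1]C pr frob {zero} _ p∣1 = prime≢1 pr (∣1⇒≡1 p∣1)
frobenius⇒∤[P∸1]C {p} {suc P′} pr frob {suc j} j<P p∣P′C[1+j] =
  frobenius⇒∤[P∸1]C pr frob (<-trans (n<1+n j) j<P) (∣m+n∣m⇒∣n p∣P′C[1+j]+P′Cj p∣P′C[1+j])
  where
  p∣P′C[1+j]+P′Cj : p ∣ P′ C suc j + P′ C j
  p∣P′C[1+j]+P′Cj = subst (p ∣_) (trans (pascal P′ j) (+-comm (P′ C j) (P′ C suc j))) (frob z<s j<P)

^-coprime-divisor : ∀ {p q} → Prime p → Coprime q p → ∀ m {δ} → p ^ m ∣ q * δ → p ^ m ∣ δ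
^-coprime-divisor pr cop zero {δ} _ = 1∣ δ
^-coprime-divisor {p} {q} pr cop (suc m) pᵐ⁺¹∣qδ
  with euclidsLemma q _ pr (∣-trans (m∣m*n (p ^ m)) pᵐ⁺¹∣qδ)
... | inj₁ p∣q = ⊥-elim (prime≢1 pr (cop (p∣q , ∣-refl)))
... | inj₂ (divides δ′ refl) = subst (p ^ suc m ∣_) (*-comm p δ′) (*-monoʳ-∣ p pᵐ∣δ′)
  where
  pᵐ∣δ′ : p ^ m ∣ δ′
  pᵐ∣δ′ = ^-coprime-divisor pr cop m (*-cancelˡ-∣ p {{prime⇒nonZero pr}}
    (subst (p ^ suc m ∣_) (trans (sym (*-assoc q δ′ p)) (*-comm (q * δ′) p)) pᵐ⁺¹∣qδ))

%-invariant⇒∣ : ∀ m n {d} .{{_ : NonZero d}} → (m + n) % d ≡ m % d → d ∣ n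
%-invariant⇒∣ m n {d} eq = divides ((m + n) / d ∸ m / d) (begin
  n
    ≡⟨ m+n∸m≡n m n ⟨
  m + n ∸ m
    ≡⟨ cong₂ _∸_ (m≡m%n+[m/n]*n (m + n) d) (m≡m%n+[m/n]*n m d) ⟩
  ((m + n) % d + (m + n) / d * d) ∸ (m % d + m / d * d)
    ≡⟨ cong (λ z → (z + (m + n) / d * d) ∸ (m % d + m / d * d)) eq ⟩
  (m % d + (m + n) / d * d) ∸ (m % d + m / d * d)
    ≡⟨ [m+n]∸[m+o]≡n∸o (m % d) _ _ ⟩
  (m + n) / d * d ∸ m / d * d
    ≡⟨ *-distribʳ-∸ d ((m + n) / d) (m / d) ⟨
  ((m + n) / d ∸ m / d) * d
    ∎)
  where open ≡-Reasoning

-- p ^ m ∣ δ q forces p ^ m ∣ δ, so a step δ ≠ 0 moves i by at least q p ^ m ≥ H p ^ m.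
progression-%-step : ∀ {p q H} → Prime p → Coprime q p → H ≤ q →
                     ∀ m i δ → .{{_ : NonZero (p ^ m)}} →
                     i + δ * q < H * p ^ m → (i + δ * q) % p ^ m ≡ i % p ^ m → δ ≡ 0
progression-%-step pr cop H≤q m i zero _ _ = refl
progression-%-step {p} {q} {H} pr cop H≤q m i δ@(suc _) i+δq<Hpᵐ eq = ⊥-elim (<⇒≱ i+δq<Hpᵐ (begin
  H * p ^ m  ≤⟨ *-monoˡ-≤ (p ^ m) H≤q ⟩
  q * p ^ m  ≤⟨ *-monoʳ-≤ q (∣⇒≤ pᵐ∣δ) ⟩
  q * δ      ≡⟨ *-comm q δ ⟩
  δ * q      ≤⟨ m≤n+m (δ * q) i ⟩
  i + δ * q  ∎))
  where
  open ≤-Reasoning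
  pᵐ∣δ : p ^ m ∣ δ
  pᵐ∣δ = ^-coprime-divisor pr cop m (subst (p ^ m ∣_) (*-comm δ q) (%-invariant⇒∣ i (δ * q) eq))

progression-%-injective : ∀ {p q H} → Prime p → Coprime q p → H ≤ q → ∀ m a {k k′} →
                          .{{_ : NonZero (p ^ m)}} → a + k * q < H * p ^ m → a + k′ * q < H * p ^ m →
                          (a + k * q) % p ^ m ≡ (a + k′ * q) % p ^ m → k ≡ k′
progression-%-injective {p} {q} {H} pr cop H≤q m a {k} {k′} lt lt′ eq =
  [ (λ k≤k′ → ordered k≤k′ lt′ eq)
  , (λ k′≤k → sym (ordered k′≤k lt (sym eq)))
  ]′ (≤-total k k′)
  where
  ordered : ∀ {k k′} → k ≤ k′ → a + k′ * q < H * p ^ m →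
            (a + k * q) % p ^ m ≡ (a + k′ * q) % p ^ m → k ≡ k′
  ordered {k} k≤k′ lt eq with δ , refl ← m≤n⇒∃[o]m+o≡n k≤k′ =
    sym (trans (cong (k +_) δ≡0) (+-identityʳ k))
    where
    shift : a + (k + δ) * q ≡ a + k * q + δ * q
    shift = trans (cong (a +_) (*-distribʳ-+ q k δ)) (sym (+-assoc a (k * q) (δ * q)))
    δ≡0 : δ ≡ 0
    δ≡0 = progression-%-step pr cop H≤q m (a + k * q) δ (subst (_< H * p ^ m) shift lt)
            (sym (trans eq (cong (_% p ^ m) shift)))

sumTo-cong : ∀ M {g g′ : ℕ → ℕ} → (∀ {k} → k ≤ M → g k ≡ g′ k) → sumTo M g ≡ sumTo M g′
sumTo-cong zero    g≡g′ = g≡g′ z≤n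
sumTo-cong (suc M) g≡g′ =
  cong₂ _+_ (sumTo-cong M (λ k≤M → g≡g′ (m≤n⇒m≤1+n k≤M))) (g≡g′ ≤-refl)

pointOfWeight : ∀ N → ℕ → Vec Bool N
pointOfWeight zero    w       = []
pointOfWeight (suc N) zero    = false ∷ pointOfWeight N zero
pointOfWeight (suc N) (suc w) = true ∷ pointOfWeight N w

weight-pointOfWeight : ∀ {N w} → w ≤ N → weight (pointOfWeight N w) ≡ w
weight-pointOfWeight {zero}  z≤n       = refl
weight-pointOfWeight {suc N} z≤n       = weight-pointOfWeight {N} z≤n
weight-pointOfWeight {suc N} (s≤s w≤N) = cong suc (weight-pointOfWeight w≤N)

fOnWeight : (p q a : ℕ) → (ℕ → Fin p) → ℕ → ℕ → ℕ
fOnWeight p q a c N w =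
  sumTo N (λ k → if a + k * q ≤ᵇ N then toℕ (c (a + k * q)) * (w C (a + k * q)) else 0)

fEval≡fOnWeight : ∀ {N} p q a c (x : Vec Bool N) → fEval p q a c x ≡ fOnWeight p q a c N (weight x)
fEval≡fOnWeight {N} p q a c x = sumTo-cong N λ {k} _ →
  cong (λ e → if a + k * q ≤ᵇ N then toℕ (c (a + k * q)) * e else 0) (esym≡C (a + k * q) x)

∣toℕ⇒≡0 : ∀ {p} (y : Fin p) → p ∣ toℕ y → toℕ y ≡ 0
∣toℕ⇒≡0 y p∣y with toℕ y | toℕ<n y
... | zero  | _   = refl
... | suc _ | y<p = ⊥-elim (>⇒∤ y<p p∣y)

suc[n∸1]≡n : ∀ {n} → 1 ≤ n → suc (n ∸ 1) ≡ n
suc[n∸1]≡n {n} 1≤n = trans (+-comm 1 (n ∸ 1)) (m∸n+n≡m 1≤n)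

module WeightBound {p q : ℕ} (pr : Prime p) (cop : Coprime q p) (a : ℕ) (c : ℕ → Fin p)
                   {N : ℕ} (e m : ℕ) (1+N≡pᵉpᵐ : suc N ≡ p ^ e * p ^ m) (pᵉ≤q : p ^ e ≤ q) where
  instance
    _ = prime⇒nonZero pr
    _ = m^n≢0 p m
  open Congruence p

  P h : ℕ
  P = p ^ m
  h = p ^ e ∸ 1

  index coeff : ℕ → ℕ
  index k = a + k * q
  coeff k = toℕ (c (index k))

  term : ℕ → ℕ → ℕ
  term w k = if index k ≤ᵇ N then coeff k * (w C index k) else 0

  Vanishes : ℕ → Set
  Vanishes k = index k ≤ N → coeff k ≡ 0

  ≤N⇒<pᵉP : ∀ {i} → i ≤ N → i < p ^ e * P
  ≤N⇒<pᵉP {i} i≤N = subst (i <_) 1+N≡pᵉpᵐ (s≤s i≤N)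

  hP+r≤N : ∀ {r} → r < P → h * P + r ≤ N
  hP+r≤N {r} r<P = ≤-pred (begin-strict
    h * P + r  <⟨ +-monoʳ-< (h * P) r<P ⟩
    h * P + P  ≡⟨ +-comm (h * P) P ⟩
    suc h * P  ≡⟨ cong (_* P) (suc[n∸1]≡n (m^n>0 p e)) ⟩
    p ^ e * P  ≡⟨ 1+N≡pᵉpᵐ ⟨
    suc N      ∎)
    where open ≤-Reasoning

  term-inRange : ∀ {w} k → index k ≤ N → term w k ≡ coeff k * (w C index k)
  term-inRange k i≤N with index k ≤ᵇ N | ≤⇒≤ᵇ i≤N
  ... | true | _ = refl

  term-outOfRange : ∀ {w} k → ¬ index k ≤ N → term w k ≡ 0
  term-outOfRange k i≰N with index k ≤ᵇ N | ≤ᵇ⇒≤ (index k) N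
  ... | false | _   = refl
  ... | true  | i≤N = ⊥-elim (i≰N (i≤N tt))

  term-vanishing : ∀ {w} k → Vanishes k → term w k ≡ 0
  term-vanishing {w} k van with index k ≤? N
  ... | yes i≤N = trans (term-inRange k i≤N) (cong (_* (w C index k)) (van i≤N))
  ... | no  i≰N = term-outOfRange k i≰N

  term-lucas : ∀ {r} k → r < P → index k ≤ N →
               term (h * P + r) k ≈ coeff k * ((h C (index k / P)) * (r C (index k % P)))
  term-lucas {r} k r<P i≤N = begin
    term (h * P + r) k
      ≡⟨ term-inRange k i≤N ⟩
    coeff k * ((h * P + r) C index k)
      ≡⟨ cong (λ i → coeff k * ((h * P + r) C i)) i≡jP+s ⟩
    coeff k * ((h * P + r) C (index k / P * P + index k % P))
      ≈⟨ *-cong (≈-refl {coeff k}) (Lucas.lucas (frobenius-^ pr m) r<P (m%n<n (index k) P) h (index k / P)) ⟩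
    coeff k * ((h C (index k / P)) * (r C (index k % P)))
      ∎
    where
    open ≈-Reasoning
    i≡jP+s : index k ≡ index k / P * P + index k % P
    i≡jP+s = trans (m≡m%n+[m/n]*n (index k) P) (+-comm (index k % P) (index k / P * P))

  module _ {d : ℕ} (F≈0 : ∀ {w} → w ≤ N → d ≤ w → fOnWeight p q a c N w ≈ 0) (d<hP : d < h * P) where

    term-off-residue≈0 : ∀ {r k} → r < P → (∀ {k} → k ≤ N → index k % P < r → Vanishes k) →
                         k ≤ N → (index k ≤ N → index k % P ≢ r) → term (h * P + r) k ≈ 0
    term-off-residue≈0 {r} {k} r<P below k≤N off with index k ≤? N
    ... | no  i≰N = ≡⇒≈ (term-outOfRange k i≰N)
    ... | yes i≤N with <-cmp (index k % P) r
    ...   | tri< s<r _ _ = ≡⇒≈ (term-vanishing k (below k≤N s<r))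
    ...   | tri≈ _ s≡r _ = ⊥-elim (off i≤N s≡r)
    ...   | tri> _ _ s>r = ≈-trans (term-lucas k r<P i≤N) (≡⇒≈ (begin
      coeff k * ((h C (index k / P)) * (r C (index k % P)))
        ≡⟨ cong (λ z → coeff k * ((h C (index k / P)) * z)) (k>n⇒nCk≡0 s>r) ⟩
      coeff k * ((h C (index k / P)) * 0)
        ≡⟨ cong (coeff k *_) (*-zeroʳ (h C (index k / P))) ⟩
      coeff k * 0
        ≡⟨ *-zeroʳ (coeff k) ⟩
      0
        ∎))
      where open ≡-Reasoning

    -- At weight h P + r, C(r, s) kills the indices of residue s > r, the induction
    -- hypothesis those of residue s < r, and a single index has residue r.
    residue-coefficient≈0 : ∀ {r} → r < P → (∀ {k} → k ≤ N → index k % P < r → Vanishes k) →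
                            ∀ {k₀} → k₀ ≤ N → index k₀ ≤ N → index k₀ % P ≡ r →
                            coeff k₀ * (h C (index k₀ / P)) ≈ 0
    residue-coefficient≈0 {r} r<P below {k₀} k₀≤N i₀≤N s₀≡r = begin
      coeff k₀ * (h C j₀)
        ≡⟨ cong (coeff k₀ *_) (*-identityʳ (h C j₀)) ⟨
      coeff k₀ * ((h C j₀) * 1)
        ≡⟨ cong (λ z → coeff k₀ * ((h C j₀) * z)) (trans (cong (r C_) s₀≡r) (nCn≡1 r)) ⟨
      coeff k₀ * ((h C j₀) * (r C (index k₀ % P)))
        ≈⟨ term-lucas k₀ r<P i₀≤N ⟨
      term w k₀
        ≈⟨ sumTo-≈-single N k₀≤N others≈0 ⟨
      fOnWeight p q a c N w
        ≈⟨ F≈0 (hP+r≤N r<P) (≤-trans (<⇒≤ d<hP) (m≤m+n (h * P) r)) ⟩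
      0
        ∎
      where
      open ≈-Reasoning
      w = h * P + r
      j₀ = index k₀ / P
      others≈0 : ∀ {k} → k ≤ N → k ≢ k₀ → term w k ≈ 0
      others≈0 k≤N k≢k₀ = term-off-residue≈0 r<P below k≤N λ i≤N s≡r →
        k≢k₀ (progression-%-injective pr cop pᵉ≤q m a (≤N⇒<pᵉP i≤N) (≤N⇒<pᵉP i₀≤N)
                                      (trans s≡r (sym s₀≡r)))

    vanishes-at-residue : ∀ {r} → r < P → (∀ {k} → k ≤ N → index k % P < r → Vanishes k) →
                          ∀ {k₀} → k₀ ≤ N → index k₀ % P ≡ r → Vanishes k₀
    vanishes-at-residue {r} r<P below {k₀} k₀≤N s₀≡r i₀≤N
      with euclidsLemma (coeff k₀) (h C (index k₀ / P)) pr
             (≈0⇒∣ (residue-coefficient≈0 r<P below k₀≤N i₀≤N s₀≡r))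
    ... | inj₁ p∣c₀   = ∣toℕ⇒≡0 (c (index k₀)) p∣c₀
    ... | inj₂ p∣hCj₀ =
      ⊥-elim (frobenius⇒∤[P∸1]C pr (frobenius-^ pr e) (m<n*o⇒m/o<n (≤N⇒<pᵉP i₀≤N)) p∣hCj₀)

    vanishes-below : ∀ r → r ≤ P → ∀ {k} → k ≤ N → index k % P < r → Vanishes k
    vanishes-below (suc r) 1+r≤P k≤N s<1+r with m≤n⇒m<n∨m≡n (≤-pred s<1+r)
    ... | inj₁ s<r = vanishes-below r (<⇒≤ 1+r≤P) k≤N s<r
    ... | inj₂ s≡r = vanishes-at-residue 1+r≤P (vanishes-below r (<⇒≤ 1+r≤P)) k≤N s≡r

    fOnWeight≈0 : ∀ w → fOnWeight p q a c N w ≈ 0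
    fOnWeight≈0 w = sumTo-≈0 N λ {k} k≤N →
      ≡⇒≈ (term-vanishing k (vanishes-below P ≤-refl k≤N (m%n<n (index k) P)))

  weight-bound : ∀ {d} → (∃ λ (x : Vec Bool N) → ¬ p ∣ fEval p q a c x) →
                 ((x : Vec Bool N) → d ≤ weight x → p ∣ fEval p q a c x) → h * P ≤ d
  weight-bound {d} (x , p∤fx) van = ≮⇒≥ λ d<hP →
    p∤fx (≈0⇒∣ (subst (_≈ 0) (sym (fEval≡fOnWeight p q a c x)) (fOnWeight≈0 F≈0 d<hP (weight x))))
    where
    F≈0 : ∀ {w} → w ≤ N → d ≤ w → fOnWeight p q a c N w ≈ 0
    F≈0 {w} w≤N d≤w = ∣⇒≈0 (subst (p ∣_)
      (trans (fEval≡fOnWeight p q a c (pointOfWeight N w))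
             (cong (fOnWeight p q a c N) (weight-pointOfWeight w≤N)))
      (van (pointOfWeight N w) (subst (d ≤_) (sym (weight-pointOfWeight w≤N)) d≤w)))

[M∸1][L∸1]≤dL⇐[L∸1]P≤d : ∀ {M L P d} → M ≡ L * P → (L ∸ 1) * P ≤ d →
                          (M ∸ 1) * (L ∸ 1) ≤ d * L
[M∸1][L∸1]≤dL⇐[L∸1]P≤d {M} {L} {P} {d} M≡LP bound = begin
  (M ∸ 1) * (L ∸ 1)  ≤⟨ *-monoˡ-≤ (L ∸ 1) (m∸n≤m M 1) ⟩
  M * (L ∸ 1)        ≡⟨ cong (_* (L ∸ 1)) M≡LP ⟩
  L * P * (L ∸ 1)    ≡⟨ *-comm (L * P) (L ∸ 1) ⟩
  (L ∸ 1) * (L * P)  ≡⟨ cong ((L ∸ 1) *_) (*-comm L P) ⟩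
  (L ∸ 1) * (P * L)  ≡⟨ *-assoc (L ∸ 1) P L ⟨
  (L ∸ 1) * P * L    ≤⟨ *-monoˡ-≤ L bound ⟩
  d * L              ∎
  where open ≤-Reasoning

[M∸1][L∸1]≤dL⇐M∸1≤d : ∀ {M L d} → M ∸ 1 ≤ d → (M ∸ 1) * (L ∸ 1) ≤ d * L
[M∸1][L∸1]≤dL⇐M∸1≤d {L = L} bound = *-mono-≤ bound (m∸n≤m L 1)

mainTheorem10 : (p n q a d ℓ : ℕ) → Prime p → n ≥ 1 → q ≥ 2 → Coprime q p →
    IsFloorLog p (q ∸ 1) ℓ →
    (c : ℕ → Fin p) →
    ∃ (λ (x : Vec Bool (p ^ n ∸ 1)) → ¬ (p ∣ fEval p q a c x)) →
    ((x : Vec Bool (p ^ n ∸ 1)) → d ≤ weight x → p ∣ fEval p q a c x) →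
    (p ^ n ∸ 1) * (p ^ ℓ ∸ 1) ≤ d * p ^ ℓ
mainTheorem10 p n q a d ℓ pr _ _ cop (pˡ≤q∸1 , _) c nonzero vanishing =
  [ (λ ℓ≤n → [M∸1][L∸1]≤dL⇐[L∸1]P≤d (pⁿ≡pᵉpᵐ ℓ (n ∸ ℓ) (m+[n∸m]≡n ℓ≤n))
                                    (bound ℓ (n ∸ ℓ) (m+[n∸m]≡n ℓ≤n) pˡ≤q))
  , (λ n≤ℓ → [M∸1][L∸1]≤dL⇐M∸1≤d {p ^ n}
               (subst (_≤ d) (*-identityʳ (p ^ n ∸ 1))
                      (bound n 0 (+-identityʳ n) (≤-trans (^-monoʳ-≤ p n≤ℓ) pˡ≤q))))
  ]′ (≤-total ℓ n)
  where
  instance _ = prime⇒nonZero pr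
  pˡ≤q : p ^ ℓ ≤ q
  pˡ≤q = ≤-trans pˡ≤q∸1 (m∸n≤m q 1)
  pⁿ≡pᵉpᵐ : ∀ e m → e + m ≡ n → p ^ n ≡ p ^ e * p ^ m
  pⁿ≡pᵉpᵐ e m e+m≡n = trans (cong (p ^_) (sym e+m≡n)) (^-distribˡ-+-* p e m)
  bound : ∀ e m → e + m ≡ n → p ^ e ≤ q → (p ^ e ∸ 1) * p ^ m ≤ d
  bound e m e+m≡n pᵉ≤q = WeightBound.weight-bound pr cop a c e m
    (trans (suc[n∸1]≡n (m^n>0 p n)) (pⁿ≡pᵉpᵐ e m e+m≡n)) pᵉ≤q nonzero vanishing
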